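{- Let $G$ be a finite group, and suppose that: $p,q>3$ are two distinct primes; $N$ is a cyclic normal subgroup of $G$ with $|N| = pq$; $S$ is a generating set of $G$; $C = (s_1, s_2, \ldots, s_n)$ is a hamiltonian cycle in $\mathrm{Cay}(G/N;S)$; there exist $s,t \in S \cup S^{ -1}$ with $\langle s^{ -1}t\rangle = N$; and $\bigl|\{\, i : s_i \in \{s, s^{ -1}\}\,\}\bigr| \ge 3$. Then $\mathrm{Cay}(G;S)$ has a hamiltonian cycle.
   Context: For a subset $S$ of a group $G$, $\mathrm{Cay}(G;S)$ is the graph with vertex set $G$ in which $g,h$ are adjacent iff $h = gs$ for some $s\in S\cup S^{ -1}$. For a normal subgroup $N$, $\mathrm{Cay}(G/N;S)$ denotes the Cayley graph of $G/N$ with respect to the image $\{sN : s\in S\}$. For $s_1,\ldots,s_n \in S\cup S^{ -1}$, $(s_1,\ldots,s_n)$ denotes the walk visiting in order the vertices $1, s_1, s_1s_2, \ldots, s_1s_2\cdots s_n$ (in $G/N$, the cosets of these elements); it is a hamiltonian cycle in $\mathrm{Cay}(G/N;S)$ if it is closed and visits every vertex of $G/N$ exactly once apart from the start/end. -}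

module Defs where

open import Level using (Level; _⊔_)
open import Algebra.Bundles using (Group)
open import Data.Nat using (ℕ; zero; suc)
open import Data.Integer using (ℤ; +_; -[1+_])
open import Data.Fin using (Fin; toℕ; _<_)
open import Data.List using (List; []; _∷_; foldr; take; length; lookup)
open import Data.List.Relation.Unary.All using (All)
open import Data.Product using (Σ; ∃; _×_; _,_)
open import Data.Sum using (_⊎_)
open import Data.Unit.Polymorphic using (⊤)
open import Relation.Binary.PropositionalEquality using (_≡_)
open import Relation.Unary using (Pred)

module GroupDefs {c ℓ : Level} (G : Group c ℓ) where
  open Group G public

  prod : List Carrier → Carrier
  prod = foldr _∙_ ε

  powℕ : Carrier → ℕ → Carrier
  powℕ g zero    = ε
  powℕ g (suc n) = g ∙ powℕ g n

  powℤ : Carrier → ℤ → Carrier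
  powℤ g (+ n)     = powℕ g n
  powℤ g -[1+ n ]  = (powℕ g (suc n)) ⁻¹

  HasSize : ∀ {p} → Pred Carrier p → ℕ → Set (c ⊔ ℓ ⊔ p)
  HasSize P m =
    Σ (Fin m → Carrier) λ f →
      (∀ i → P (f i)) ×
      (∀ i j → f i ≈ f j → i ≡ j) ×
      (∀ x → P x → ∃ λ i → x ≈ f i)

  Finite : Set (c ⊔ ℓ)
  Finite = ∃ λ n → HasSize {ℓ} (λ _ → ⊤) n

  record IsNormalSubgroup {p} (N : Pred Carrier p) : Set (c ⊔ ℓ ⊔ p) where
    field
      resp  : ∀ {x y} → x ≈ y → N x → N y
      ε∈    : N ε
      ∙-closed : ∀ {x y} → N x → N y → N (x ∙ y)
      ⁻¹-closed : ∀ {x} → N x → N (x ⁻¹)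
      conj-closed : ∀ g {x} → N x → N ((g ∙ x) ∙ g ⁻¹)

  ⟨_⟩ : Carrier → Pred Carrier ℓ
  ⟨ g ⟩ x = ∃ λ (k : ℤ) → x ≈ powℤ g k

  SameSet : ∀ {p q} → Pred Carrier p → Pred Carrier q → Set (c ⊔ p ⊔ q)
  SameSet P Q = (∀ x → P x → Q x) × (∀ x → Q x → P x)

  IsCyclic : ∀ {p} → Pred Carrier p → Set (c ⊔ ℓ ⊔ p)
  IsCyclic N = ∃ λ g → SameSet ⟨ g ⟩ N

  SymClosure : ∀ {p} → Pred Carrier p → Pred Carrier (c ⊔ ℓ ⊔ p)
  SymClosure S x = ∃ λ y → S y × (x ≈ y ⊎ x ≈ y ⁻¹)

  Generates : ∀ {p} → Pred Carrier p → Set (c ⊔ ℓ ⊔ p)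
  Generates S = ∀ x → ∃ λ (w : List Carrier) → All (SymClosure S) w × prod w ≈ x

  vertex : List Carrier → ℕ → Carrier
  vertex w k = prod (take k w)

  -- (s₁,…,sₙ) is a hamiltonian cycle in the Cayley graph with respect to S,
  -- where vertices x, y of the graph are identified when Same x y holds
  -- (Same = ≈ for Cay(G;S); Same x y = "xN = yN" for Cay(G/N;S)).
  IsHamCycleMod : ∀ {p r} → Pred Carrier p → (Carrier → Carrier → Set r) →
                  List Carrier → Set (c ⊔ ℓ ⊔ p ⊔ r)
  IsHamCycleMod S Same w =
    All (SymClosure S) w ×
    Same (vertex w (length w)) ε ×
    (∀ (i j : Fin (length w)) → Same (vertex w (toℕ i)) (vertex w (toℕ j)) → i ≡ j) ×
    (∀ x → ∃ λ (i : Fin (length w)) → Same x (vertex w (toℕ i)))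

  SameCoset : ∀ {p} → Pred Carrier p → Carrier → Carrier → Set p
  SameCoset N x y = N (x ⁻¹ ∙ y)

  IsHamCycleQuot : ∀ {p q} → Pred Carrier p → Pred Carrier q → List Carrier → Set (c ⊔ ℓ ⊔ p ⊔ q)
  IsHamCycleQuot S N w = IsHamCycleMod S (SameCoset N) w

  HasHamCycle : ∀ {p} → Pred Carrier p → Set (c ⊔ ℓ ⊔ p)
  HasHamCycle S = ∃ λ (w : List Carrier) → IsHamCycleMod S _≈_ w

  AtLeast3Occ : List Carrier → Carrier → Set ℓ
  AtLeast3Occ w s =
    ∃ λ (i : Fin (length w)) → ∃ λ (j : Fin (length w)) → ∃ λ (k : Fin (length w)) →
      i < j × j < k ×
      (lookup w i ≈ s ⊎ lookup w i ≈ s ⁻¹) ×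
      (lookup w j ≈ s ⊎ lookup w j ≈ s ⁻¹) ×
      (lookup w k ≈ s ⊎ lookup w k ≈ s ⁻¹)

{-# OPTIONS --safe #-}
-- Write h = s⁻¹t; it generates N, which is cyclic of order pq. Replacing an occurrence of s^{±1}
-- in C by t^{±1} keeps C a hamiltonian cycle of Cay(G/N;S), and multiplies its product by a
-- conjugate of h^{±1}, that is by h^c with c coprime to pq. Choosing independently whether to
-- swap each of three occurrences gives eight cycles with products h^(c₀ + b₁c₁ + b₂c₂ + b₃c₃),
-- bᵢ ∈ {0,1}. For a prime r > 2, the vertices b of the cube {0,1}³ with r ∣ c₀ + Σ bᵢcᵢ contain
-- no edge of the cube and not all four vertices of even weight, so some b works for both p and
-- q; the product of that cycle then generates N, and by the Factor Group Lemma the cycle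
-- traversed pq times is a hamiltonian cycle of Cay(G;S).
module Submission where

open import Algebra.Bundles using (Group)
open import Data.Bool using (Bool; true; false; if_then_else_)
open import Data.Empty using (⊥-elim)
open import Data.Fin as Fin using (Fin; toℕ; fromℕ<; punchOut; combine; cast)
open import Data.Fin.Properties
  using (any?; _≟_; punchOut-injective; injective⇒≤; combine-surjective; toℕ-combine; toℕ-injective;
         toℕ<n; toℕ-fromℕ<; toℕ-cast; pigeonhole; nonZeroIndex)
import Data.Integer as ℤ
open import Data.List using (List; []; _∷_; _++_; length; lookup; concat; replicate; map)
open import Data.List.Properties using (length-++; take-all)
open import Data.List.Relation.Binary.Pointwise
  using (Pointwise; []; _∷_; ++⁺ˡ; Pointwise-length; All-resp-Pointwise) renaming (refl to Pointwise-refl)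
open import Data.List.Relation.Unary.All using (All)
open import Data.List.Relation.Unary.All.Properties using (concat⁺; replicate⁺)
open import Data.Nat
  using (ℕ; zero; suc; _+_; _*_; _∸_; _%_; _<_; _≤_; s≤s; s<s; NonZero; >-nonZero; nonTrivial⇒≢1)
open import Data.Nat.Coprimality as Coprimality using (Coprime; coprime-divisor)
open import Data.Nat.DivMod using (_/_; m≡m%n+[m/n]*n; m%n<n)
open import Data.Nat.Divisibility
  using (_∣_; divides; _∣?_; ∣-refl; ∣-trans; ∣-antisym; ∣⇒≤; >⇒∤; ∣m+n∣m⇒∣n; ∣m∣n⇒∣m+n;
         m∣m*n; n∣m*n; ∣m⇒∣m*n; *-monoʳ-∣; m%n≡0⇒n∣m)
open import Data.Nat.ListAction using (sum)
open import Data.Nat.Primality using (Prime; prime; euclidsLemma; prime⇒irreducible; prime⇒nonZero)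
open import Data.Nat.Properties
  using (<⇒≱; <⇒≤; <⇒≤pred; <-trans; n<1+n; 1+n≰n; m<n⇒0<n∸m; +-comm; +-assoc; *-comm;
         *-identityʳ; *-cancelˡ-≡; m*n≢0; ≤-refl; ≤-total; ≤-antisym; ≤-trans; ≤-<-trans; m∸n≤m;
         m∸n≡0⇒m≤n; m+[n∸m]≡n)
open import Data.Nat.Tactic.RingSolver using (solve-∀)
open import Data.Product using (∃; ∃-syntax; _×_; _,_; proj₁; proj₂)
open import Data.Sum using (_⊎_; inj₁; inj₂)
open import Function using (_∘_)
open import Function.Bundles using (_⇔_; mk⇔; module Equivalence)
open import Function.Definitions using (Injective)
open import Level using (Level)
open import Relation.Binary using (Rel; Reflexive)
open import Relation.Binary.PropositionalEquality as ≡ using (_≡_; _≢_)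
open import Relation.Nullary using (¬_; Dec; yes; no; contradiction)
open import Relation.Unary using (Pred)
open import Defs

coprime-*ʳ : ∀ {a b c} → Coprime a b → Coprime a c → Coprime a (b * c)
coprime-*ʳ {b = b} a⊥b a⊥c {d} (d∣a , d∣bc) = a⊥c (d∣a , coprime-divisor d⊥b d∣bc)
  where
  d⊥b : Coprime d b
  d⊥b (e∣d , e∣b) = a⊥b (∣-trans e∣d d∣a , e∣b)

prime∤⇒coprime : ∀ {p n} → Prime p → ¬ p ∣ n → Coprime p n
prime∤⇒coprime p-prime p∤n (d∣p , d∣n) with prime⇒irreducible p-prime d∣p
... | inj₁ d≡1    = d≡1
... | inj₂ ≡.refl = contradiction d∣n p∤n

coprime⇒prime∤ : ∀ {p m n} → Prime p → p ∣ m → Coprime m n → ¬ p ∣ n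
coprime⇒prime∤ (prime _) p∣m m⊥n p∣n = nonTrivial⇒≢1 (m⊥n (p∣m , p∣n))

prime*prime-coprime : ∀ {p q n} → Prime p → Prime q → ¬ p ∣ n → ¬ q ∣ n → Coprime (p * q) n
prime*prime-coprime p-prime q-prime p∤n q∤n =
  Coprimality.sym (coprime-*ʳ (Coprimality.sym (prime∤⇒coprime p-prime p∤n))
                              (Coprimality.sym (prime∤⇒coprime q-prime q∤n)))

-- The cube {0,1}³

record SparseCube (X : Bool → Bool → Bool → Set) : Set where
  field
    no-edge₁ : ∀ {y z} → X false y z → ¬ X true y z
    no-edge₂ : ∀ {x z} → X x false z → ¬ X x true z
    no-edge₃ : ∀ {x y} → X x y false → ¬ X x y true
    misses-even-vertex : X false false false → X true true false → X true false true → ¬ X false true true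

CubeDecidable : (Bool → Bool → Bool → Set) → Set
CubeDecidable X = ∀ x y z → Dec (X x y z)

Uncovered : (X Y : Bool → Bool → Bool → Set) → Set
Uncovered X Y = ∃ λ x → ∃ λ y → ∃ λ z → ¬ X x y z × ¬ Y x y z

uncovered-from-origin : ∀ {X Y} → CubeDecidable X → CubeDecidable Y → SparseCube X → SparseCube Y →
                        X false false false → Uncovered X Y
uncovered-from-origin X? Y? sX sY x₀ with Y? true false false | Y? false true false | Y? false false true
... | no ¬y  | _      | _     = true , false , false , SparseCube.no-edge₁ sX x₀ , ¬y
... | yes _  | no ¬y  | _     = false , true , false , SparseCube.no-edge₂ sX x₀ , ¬y
... | yes _  | yes _  | no ¬y = false , false , true , SparseCube.no-edge₃ sX x₀ , ¬y
... | yes y₁ | yes y₂ | yes _ with X? true true false | X? true false true | X? false true true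
...   | no ¬x  | _      | _     = true , true , false , ¬x , SparseCube.no-edge₂ sY y₁
...   | yes _  | no ¬x  | _     = true , false , true , ¬x , SparseCube.no-edge₃ sY y₁
...   | yes _  | yes _  | no ¬x = false , true , true , ¬x , SparseCube.no-edge₃ sY y₂
...   | yes x₁ | yes x₂ | yes x₃ = ⊥-elim (SparseCube.misses-even-vertex sX x₀ x₁ x₂ x₃)

sparse-cubes-uncovered : ∀ {X Y} → CubeDecidable X → CubeDecidable Y → SparseCube X → SparseCube Y →
                         Uncovered X Y
sparse-cubes-uncovered X? Y? sX sY with X? false false false | Y? false false false
... | yes x₀ | _ = uncovered-from-origin X? Y? sX sY x₀
... | no ¬x  | yes y₀ with uncovered-from-origin Y? X? sY sX y₀
...   | x , y , z , ¬y , ¬x′ = x , y , z , ¬x′ , ¬y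
sparse-cubes-uncovered X? Y? sX sY | no ¬x | no ¬y = false , false , false , ¬x , ¬y

bit : ℕ → Bool → ℕ
bit c b = if b then c else 0

cubeSum : ℕ → ℕ → ℕ → ℕ → Bool → Bool → Bool → ℕ
cubeSum c₀ c₁ c₂ c₃ b₁ b₂ b₃ = c₀ + sum (bit c₁ b₁ ∷ bit c₂ b₂ ∷ bit c₃ b₃ ∷ [])

divisibility-sparse : ∀ {r} → Prime r → 2 < r → ∀ c₀ {c₁ c₂ c₃} → ¬ r ∣ c₁ → ¬ r ∣ c₂ → ¬ r ∣ c₃ →
                      SparseCube (λ b₁ b₂ b₃ → r ∣ cubeSum c₀ c₁ c₂ c₃ b₁ b₂ b₃)
divisibility-sparse {r} r-prime 2<r c₀ {c₁} {c₂} {c₃} r∤c₁ r∤c₂ r∤c₃ = record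
  { no-edge₁ = ∤-translate (step₁ c₀ c₁ _) r∤c₁
  ; no-edge₂ = λ {x} → ∤-translate (step₂ c₀ (bit c₁ x) c₂ _) r∤c₂
  ; no-edge₃ = λ {x} {y} → ∤-translate (step₃ c₀ (bit c₁ x) (bit c₂ y) c₃) r∤c₃
  ; misses-even-vertex = λ r∣f₀₀₀ r∣f₁₁₀ r∣f₁₀₁ r∣f₀₁₁ → r∤2c₁ (∣m+n∣m⇒∣n
      (≡.subst (r ∣_) (even c₀ c₁ c₂ c₃) (∣m∣n⇒∣m+n r∣f₁₁₀ r∣f₁₀₁))
      (∣m∣n⇒∣m+n r∣f₀₁₁ r∣f₀₀₀))
  }
  where
  ∤-translate : ∀ {a b c} → b ≡ a + c → ¬ r ∣ c → r ∣ a → ¬ r ∣ b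
  ∤-translate ≡.refl r∤c r∣a r∣a+c = r∤c (∣m+n∣m⇒∣n r∣a+c r∣a)
  step₁ : ∀ c₀ c R → c₀ + (c + R) ≡ c₀ + R + c
  step₁ = solve-∀
  step₂ : ∀ c₀ a c R → c₀ + (a + (c + R)) ≡ c₀ + (a + R) + c
  step₂ = solve-∀
  step₃ : ∀ c₀ a b c → c₀ + (a + (b + (c + 0))) ≡ c₀ + (a + (b + 0)) + c
  step₃ = solve-∀
  even : ∀ c₀ a b c → c₀ + (a + (b + 0)) + (c₀ + (a + (c + 0))) ≡ c₀ + (b + (c + 0)) + (c₀ + 0) + 2 * a
  even = solve-∀
  r∤2c₁ : ¬ r ∣ 2 * c₁
  r∤2c₁ r∣2c₁ with euclidsLemma 2 c₁ r-prime r∣2c₁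
  ... | inj₁ r∣2  = <⇒≱ 2<r (∣⇒≤ r∣2)
  ... | inj₂ r∣c₁ = r∤c₁ r∣c₁

coprime-cubeSum : ∀ {p q} → Prime p → Prime q → 2 < p → 2 < q → ∀ c₀ {c₁ c₂ c₃} →
                  Coprime (p * q) c₁ → Coprime (p * q) c₂ → Coprime (p * q) c₃ →
                  ∃ λ b₁ → ∃ λ b₂ → ∃ λ b₃ → Coprime (p * q) (cubeSum c₀ c₁ c₂ c₃ b₁ b₂ b₃)
coprime-cubeSum {p} {q} p-prime q-prime 2<p 2<q c₀ c₁⊥ c₂⊥ c₃⊥ =
  let b₁ , b₂ , b₃ , p∤ , q∤ = sparse-cubes-uncovered (λ _ _ _ → p ∣? _) (λ _ _ _ → q ∣? _)
        (divisibility-sparse p-prime 2<p c₀ (p∤ c₁⊥) (p∤ c₂⊥) (p∤ c₃⊥))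
        (divisibility-sparse q-prime 2<q c₀ (q∤ c₁⊥) (q∤ c₂⊥) (q∤ c₃⊥))
  in b₁ , b₂ , b₃ , prime*prime-coprime p-prime q-prime p∤ q∤
  where
  p∤ : ∀ {c} → Coprime (p * q) c → ¬ p ∣ c
  p∤ = coprime⇒prime∤ p-prime (m∣m*n q)
  q∤ : ∀ {c} → Coprime (p * q) c → ¬ q ∣ c
  q∤ = coprime⇒prime∤ q-prime (n∣m*n p)

Fin-injective⇒surjective : ∀ {n} {f : Fin n → Fin n} → Injective _≡_ _≡_ f → ∀ j → ∃ λ i → f i ≡ j
Fin-injective⇒surjective {suc n} {f} f-injective j with any? (λ i → f i ≟ j)
... | yes found = found
... | no none   = contradiction (injective⇒≤ {f = λ i → punchOut (j≢f i)} punchOut-f-injective) 1+n≰n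
  where
  j≢f : ∀ i → j ≢ f i
  j≢f i j≡fi = none (i , ≡.sym j≡fi)
  punchOut-f-injective : ∀ {i i′} → punchOut (j≢f i) ≡ punchOut (j≢f i′) → i ≡ i′
  punchOut-f-injective eq = f-injective (punchOut-injective (j≢f _) (j≢f _) eq)

toℕ-combine′ : ∀ {m n} (a : Fin m) (i : Fin n) → toℕ (combine a i) ≡ toℕ a * n + toℕ i
toℕ-combine′ {n = n} a i = ≡.trans (toℕ-combine a i) (≡.cong (_+ toℕ i) (*-comm n (toℕ a)))

Fin-decompose : ∀ {m n} (k : Fin (m * n)) →
                ∃ λ (a : Fin m) → ∃ λ (i : Fin n) → toℕ k ≡ toℕ a * n + toℕ i
Fin-decompose k =
  let a , i , combine≡k = combine-surjective k
  in a , i , ≡.trans (≡.cong toℕ (≡.sym combine≡k)) (toℕ-combine′ a i)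

module _ {a} {A : Set a} where

  split-at : (xs : List A) (i : Fin (length xs)) → ∃[ as ] ∃[ bs ] xs ≡ as ++ lookup xs i ∷ bs
  split-at (x ∷ xs) Fin.zero    = [] , xs , ≡.refl
  split-at (x ∷ xs) (Fin.suc i) = let as , bs , eq = split-at xs i in x ∷ as , bs , ≡.cong (x ∷_) eq

  split-at₂ : (xs : List A) {i j : Fin (length xs)} → i Fin.< j →
              ∃[ as ] ∃[ bs ] ∃[ cs ] xs ≡ as ++ lookup xs i ∷ bs ++ lookup xs j ∷ cs
  split-at₂ (x ∷ xs) {Fin.zero} {Fin.suc j} _ =
    let bs , cs , eq = split-at xs j in [] , bs , cs , ≡.cong (x ∷_) eq
  split-at₂ (x ∷ xs) {Fin.suc i} {Fin.suc j} (s<s i<j) =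
    let as , bs , cs , eq = split-at₂ xs i<j in x ∷ as , bs , cs , ≡.cong (x ∷_) eq

  split-at₃ : (xs : List A) {i j k : Fin (length xs)} → i Fin.< j → j Fin.< k →
              ∃[ as ] ∃[ bs ] ∃[ cs ] ∃[ ds ]
                xs ≡ as ++ lookup xs i ∷ bs ++ lookup xs j ∷ cs ++ lookup xs k ∷ ds
  split-at₃ (x ∷ xs) {Fin.zero} {Fin.suc j} {Fin.suc k} _ (s<s j<k) =
    let bs , cs , ds , eq = split-at₂ xs j<k in [] , bs , cs , ds , ≡.cong (x ∷_) eq
  split-at₃ (x ∷ xs) {Fin.suc i} {Fin.suc j} {Fin.suc k} (s<s i<j) (s<s j<k) =
    let as , bs , cs , ds , eq = split-at₃ xs i<j j<k in x ∷ as , bs , cs , ds , ≡.cong (x ∷_) eq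

  Pointwise-swap₃ : ∀ {r} {R : Rel A r} → Reflexive R → ∀ as bs cs ds {x₁ y₁ x₂ y₂ x₃ y₃} →
                    R x₁ y₁ → R x₂ y₂ → R x₃ y₃ → ∀ b₁ b₂ b₃ →
                    Pointwise R (as ++ x₁ ∷ bs ++ x₂ ∷ cs ++ x₃ ∷ ds)
                                (as ++ (if b₁ then y₁ else x₁) ∷ bs ++ (if b₂ then y₂ else x₂) ∷
                                 cs ++ (if b₃ then y₃ else x₃) ∷ ds)
  Pointwise-swap₃ {R = R} rfl as bs cs ds r₁ r₂ r₃ b₁ b₂ b₃ =
    ++⁺ˡ {R = R} rfl as (swap r₁ b₁ ∷
    ++⁺ˡ {R = R} rfl bs (swap r₂ b₂ ∷
    ++⁺ˡ {R = R} rfl cs (swap r₃ b₃ ∷ Pointwise-refl {R = R} rfl)))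
    where
    swap : ∀ {x y} → R x y → ∀ b → R x (if b then y else x)
    swap r true  = r
    swap _ false = rfl

module _ {c ℓ : Level} (G : Group c ℓ) where
  open GroupDefs G
  open import Algebra.Properties.Group G
    using (ε⁻¹≈ε; inverseʳ-unique; ⁻¹-anti-homo-∙; ⁻¹-involutive; identityˡ-unique; identityʳ-unique;
           ∙-cancelˡ; ∙-cancelʳ; \\-leftDividesˡ; \\-leftDividesʳ)
  open import Algebra.Properties.Monoid monoid using (cancelᶜ; cancelʳ; insertʳ)
  open import Algebra.Properties.Monoid.Mult monoid using (×-homo-+; ×-assocˡ) renaming (_×_ to _·_)
  open import Relation.Binary.Reasoning.Setoid setoid
  open import Tactic.MonoidSolver using (solve)
  open Equivalence

  -- Powers, conjugates and orders

  conj : Carrier → Carrier → Carrier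
  conj g x = g ⁻¹ ∙ (x ∙ g)

  powℕ≡· : ∀ g n → powℕ g n ≡ n · g
  powℕ≡· g zero    = ≡.refl
  powℕ≡· g (suc n) = ≡.cong (g ∙_) (powℕ≡· g n)

  pow-cong : ∀ {x y} n → x ≈ y → powℕ x n ≈ powℕ y n
  pow-cong zero    _   = refl
  pow-cong (suc n) x≈y = ∙-cong x≈y (pow-cong n x≈y)

  pow-+ : ∀ g a b → powℕ g (a + b) ≈ powℕ g a ∙ powℕ g b
  pow-+ g a b rewrite powℕ≡· g (a + b) | powℕ≡· g a | powℕ≡· g b = ×-homo-+ g a b

  pow-pow : ∀ g a b → powℕ (powℕ g a) b ≈ powℕ g (b * a)
  pow-pow g a b rewrite powℕ≡· (powℕ g a) b | powℕ≡· g a | powℕ≡· g (b * a) = ×-assocˡ g b a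

  pow-ε : ∀ n → powℕ ε n ≈ ε
  pow-ε zero    = refl
  pow-ε (suc n) = trans (identityˡ _) (pow-ε n)

  pow-∙ʳ : ∀ g n → powℕ g n ∙ g ≈ powℕ g (suc n)
  pow-∙ʳ g n = begin
    powℕ g n ∙ g         ≈⟨ ∙-congˡ (identityʳ g) ⟨
    powℕ g n ∙ powℕ g 1  ≈⟨ pow-+ g n 1 ⟨
    powℕ g (n + 1)       ≡⟨ ≡.cong (powℕ g) (+-comm n 1) ⟩
    powℕ g (suc n)       ∎

  pow-⁻¹ : ∀ g n → powℕ (g ⁻¹) n ≈ powℕ g n ⁻¹
  pow-⁻¹ g zero    = sym ε⁻¹≈ε
  pow-⁻¹ g (suc n) = begin
    g ⁻¹ ∙ powℕ (g ⁻¹) n  ≈⟨ ∙-congˡ (pow-⁻¹ g n) ⟩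
    g ⁻¹ ∙ powℕ g n ⁻¹    ≈⟨ ⁻¹-anti-homo-∙ (powℕ g n) g ⟨
    (powℕ g n ∙ g) ⁻¹     ≈⟨ ⁻¹-cong (pow-∙ʳ g n) ⟩
    powℕ g (suc n) ⁻¹     ∎

  pow-multiple : ∀ {g d n} → powℕ g d ≈ ε → d ∣ n → powℕ g n ≈ ε
  pow-multiple {g} {d} g^d≈ε (divides k ≡.refl) = begin
    powℕ g (k * d)     ≈⟨ pow-pow g d k ⟨
    powℕ (powℕ g d) k  ≈⟨ pow-cong k g^d≈ε ⟩
    powℕ ε k           ≈⟨ pow-ε k ⟩
    ε                  ∎

  pow-mod : ∀ {g d} .{{_ : NonZero d}} → powℕ g d ≈ ε → ∀ n → powℕ g n ≈ powℕ g (n % d)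
  pow-mod {g} {d} g^d≈ε n = begin
    powℕ g n                             ≡⟨ ≡.cong (powℕ g) (m≡m%n+[m/n]*n n d) ⟩
    powℕ g (n % d + n / d * d)           ≈⟨ pow-+ g (n % d) _ ⟩
    powℕ g (n % d) ∙ powℕ g (n / d * d)  ≈⟨ ∙-congˡ (pow-multiple g^d≈ε (n∣m*n (n / d))) ⟩
    powℕ g (n % d) ∙ ε                   ≈⟨ identityʳ _ ⟩
    powℕ g (n % d)                       ∎

  pow-≈⇒pow-∸≈ε : ∀ g {a b} → a ≤ b → powℕ g a ≈ powℕ g b → powℕ g (b ∸ a) ≈ ε
  pow-≈⇒pow-∸≈ε g {a} {b} a≤b g^a≈g^b = identityʳ-unique (powℕ g a) _ (begin
    powℕ g a ∙ powℕ g (b ∸ a)  ≈⟨ pow-+ g a (b ∸ a) ⟨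
    powℕ g (a + (b ∸ a))       ≡⟨ ≡.cong (powℕ g) (m+[n∸m]≡n a≤b) ⟩
    powℕ g b                   ≈⟨ g^a≈g^b ⟨
    powℕ g a                   ∎)

  pow-⁻¹-period : ∀ {g d r} → powℕ g d ≈ ε → r ≤ d → powℕ g r ⁻¹ ≈ powℕ g (d ∸ r)
  pow-⁻¹-period {g} {d} {r} g^d≈ε r≤d = sym (inverseʳ-unique (powℕ g r) _ (begin
    powℕ g r ∙ powℕ g (d ∸ r)  ≈⟨ pow-+ g r (d ∸ r) ⟨
    powℕ g (r + (d ∸ r))       ≡⟨ ≡.cong (powℕ g) (m+[n∸m]≡n r≤d) ⟩
    powℕ g d                   ≈⟨ g^d≈ε ⟩
    ε                          ∎))

  powℤ-reduce : ∀ {g d} .{{_ : NonZero d}} → powℕ g d ≈ ε →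
                ∀ k → ∃ λ (a : Fin d) → powℤ g k ≈ powℕ g (toℕ a)
  powℤ-reduce {g} {d} g^d≈ε (ℤ.+ n) =
    fromℕ< (m%n<n n d) ,
    trans (pow-mod g^d≈ε n) (reflexive (≡.cong (powℕ g) (≡.sym (toℕ-fromℕ< (m%n<n n d)))))
  powℤ-reduce {g} {d} g^d≈ε ℤ.-[1+ n ] =
    let a , g^[d∸r]≈g^a = powℤ-reduce g^d≈ε (ℤ.+ (d ∸ suc n % d))
    in a , trans (⁻¹-cong (pow-mod g^d≈ε (suc n)))
                 (trans (pow-⁻¹-period g^d≈ε (<⇒≤ (m%n<n (suc n) d))) g^[d∸r]≈g^a)

  conj-ε : ∀ g → conj g ε ≈ ε
  conj-ε g = trans (∙-congˡ (identityˡ g)) (inverseˡ g)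

  conj-∙ : ∀ g x y → conj g x ∙ conj g y ≈ conj g (x ∙ y)
  conj-∙ g x y = begin
    g ⁻¹ ∙ (x ∙ g) ∙ (g ⁻¹ ∙ (y ∙ g))  ≈⟨ solve monoid ⟩
    (g ⁻¹ ∙ x ∙ g) ∙ (g ⁻¹ ∙ (y ∙ g))  ≈⟨ cancelᶜ (inverseʳ g) (g ⁻¹ ∙ x) (y ∙ g) ⟩
    (g ⁻¹ ∙ x) ∙ (y ∙ g)               ≈⟨ solve monoid ⟩
    g ⁻¹ ∙ ((x ∙ y) ∙ g)               ∎

  conj≈ε⇒≈ε : ∀ g x → conj g x ≈ ε → x ≈ ε
  conj≈ε⇒≈ε g x gxg≈ε =
    identityˡ-unique x g (∙-cancelˡ (g ⁻¹) (x ∙ g) g (trans gxg≈ε (sym (inverseˡ g))))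

  pow-conj : ∀ g x n → powℕ (conj g x) n ≈ conj g (powℕ x n)
  pow-conj g x zero    = sym (conj-ε g)
  pow-conj g x (suc n) = trans (∙-congˡ (pow-conj g x n)) (conj-∙ g x (powℕ x n))

  HasOrder : Carrier → ℕ → Set ℓ
  HasOrder g m = ∀ e → powℕ g e ≈ ε ⇔ m ∣ e

  HasOrder-cong : ∀ {x y m} → x ≈ y → HasOrder x m → HasOrder y m
  HasOrder-cong x≈y ord e =
    mk⇔ (to (ord e) ∘ trans (pow-cong e x≈y)) (trans (pow-cong e (sym x≈y)) ∘ from (ord e))

  HasOrder-⁻¹ : ∀ {g m} → HasOrder g m → HasOrder (g ⁻¹) m
  HasOrder-⁻¹ {g} ord e = mk⇔ (to (ord e) ∘ ⁻¹≈ε⇒≈ε ∘ trans (sym (pow-⁻¹ g e)))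
                              (λ m∣e → trans (pow-⁻¹ g e) (trans (⁻¹-cong (from (ord e) m∣e)) ε⁻¹≈ε))
    where
    ⁻¹≈ε⇒≈ε : ∀ {x} → x ⁻¹ ≈ ε → x ≈ ε
    ⁻¹≈ε⇒≈ε {x} x⁻¹≈ε = trans (sym (⁻¹-involutive x)) (trans (⁻¹-cong x⁻¹≈ε) ε⁻¹≈ε)

  HasOrder-conj : ∀ g {x m} → HasOrder x m → HasOrder (conj g x) m
  HasOrder-conj g {x} ord e =
    mk⇔ (to (ord e) ∘ conj≈ε⇒≈ε g _ ∘ trans (sym (pow-conj g x e)))
        (λ m∣e → trans (pow-conj g x e) (trans (∙-congˡ (∙-congʳ (from (ord e) m∣e))) (conj-ε g)))

  HasOrder-intro : ∀ {g m} .{{_ : NonZero m}} → powℕ g m ≈ ε →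
                   (∀ d → .{{_ : NonZero d}} → powℕ g d ≈ ε → m ≤ d) → HasOrder g m
  HasOrder-intro {g} {m} g^m≈ε minimal e = mk⇔ m∣e (pow-multiple g^m≈ε)
    where
    m∣e : powℕ g e ≈ ε → m ∣ e
    m∣e g^e≈ε with e % m in e%m≡r
    ... | zero  = m%n≡0⇒n∣m e m e%m≡r
    ... | suc r = contradiction (minimal (suc r) g^r≈ε) (<⇒≱ (≡.subst (_< m) e%m≡r (m%n<n e m)))
      where
      g^r≈ε : powℕ g (suc r) ≈ ε
      g^r≈ε = trans (reflexive (≡.cong (powℕ g) (≡.sym e%m≡r))) (trans (sym (pow-mod g^m≈ε e)) g^e≈ε)

  HasOrder-pow : ∀ {g m c} → HasOrder g m → Coprime m c → HasOrder (powℕ g c) m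
  HasOrder-pow {g} {m} {c} ord m⊥c e = mk⇔
    (λ g^ce≈ε → coprime-divisor m⊥c
                  (≡.subst (m ∣_) (*-comm e c) (to (ord (e * c)) (trans (sym (pow-pow g c e)) g^ce≈ε))))
    (λ m∣e → trans (pow-pow g c e) (from (ord (e * c)) (∣m⇒∣m*n c m∣e)))

  -- With m = k d and d ∣ c, the element g^c already has order dividing k, so k = m and d = 1.
  HasOrder-pow⇒coprime : ∀ {g m c} .{{_ : NonZero m}} → HasOrder g m → HasOrder (powℕ g c) m → Coprime m c
  HasOrder-pow⇒coprime {g} {m} {c} ord ordᶜ {d} (divides k m≡k*d , d∣c) =
    *-cancelˡ-≡ d 1 m (≡.trans (≡.cong (_* d) (≡.sym k≡m)) (≡.trans (≡.sym m≡k*d) (≡.sym (*-identityʳ m))))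
    where
    m∣k*c : m ∣ k * c
    m∣k*c = ≡.subst (_∣ k * c) (≡.sym m≡k*d) (*-monoʳ-∣ k d∣c)
    k≡m : k ≡ m
    k≡m = ∣-antisym (≡.subst (k ∣_) (≡.sym m≡k*d) (m∣m*n d))
                    (to (ordᶜ k) (trans (pow-pow g c k) (from (ord (k * c)) m∣k*c)))

  HasOrder-pow-≈⇒≥ : ∀ {g m a b} → HasOrder g m → a ≤ b → b < m → powℕ g a ≈ powℕ g b → b ≤ a
  HasOrder-pow-≈⇒≥ {g} {m} {a} {b} ord a≤b b<m g^a≈g^b
    with b ∸ a in b∸a≡d | to (ord (b ∸ a)) (pow-≈⇒pow-∸≈ε g a≤b g^a≈g^b)
  ... | zero  | _   = m∸n≡0⇒m≤n b∸a≡d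
  ... | suc d | m∣d = contradiction m∣d (>⇒∤ (≡.subst (_< m) b∸a≡d (≤-<-trans (m∸n≤m b a) b<m)))

  HasOrder-pow-injective : ∀ {g m a b} → HasOrder g m → a < m → b < m → powℕ g a ≈ powℕ g b → a ≡ b
  HasOrder-pow-injective ord a<m b<m g^a≈g^b with ≤-total _ _
  ... | inj₁ a≤b = ≤-antisym a≤b (HasOrder-pow-≈⇒≥ ord a≤b b<m g^a≈g^b)
  ... | inj₂ b≤a = ≤-antisym (HasOrder-pow-≈⇒≥ ord b≤a a<m (sym g^a≈g^b)) b≤a

  module _ {ℓN} {N : Pred Carrier ℓN} {m : ℕ} (size : HasSize N m) where
    private
      F : Fin m → Carrier
      F = proj₁ size
      F∈N : ∀ i → N (F i)
      F∈N = proj₁ (proj₂ size)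
      F-injective : ∀ i j → F i ≈ F j → i ≡ j
      F-injective = proj₁ (proj₂ (proj₂ size))
      F-onto : ∀ x → N x → ∃ λ i → x ≈ F i
      F-onto = proj₂ (proj₂ (proj₂ size))

    HasSize-injective⇒onto : (f : Fin m → Carrier) → (∀ i → N (f i)) → (∀ i j → f i ≈ f j → i ≡ j) →
                             ∀ x → N x → ∃ λ i → x ≈ f i
    HasSize-injective⇒onto f f∈N f-injective x x∈N =
      let j , x≈Fj = F-onto x x∈N
          i , ιi≡j = Fin-injective⇒surjective ι-injective j
      in i , trans x≈Fj (trans (reflexive (≡.cong F (≡.sym ιi≡j))) (sym (fi≈Fιi i)))
      where
      ι : Fin m → Fin m
      ι i = proj₁ (F-onto (f i) (f∈N i))
      fi≈Fιi : ∀ i → f i ≈ F (ι i)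
      fi≈Fιi i = proj₂ (F-onto (f i) (f∈N i))
      ι-injective : ∀ {i i′} → ι i ≡ ι i′ → i ≡ i′
      ι-injective {i} {i′} eq =
        f-injective i i′ (trans (fi≈Fιi i) (trans (reflexive (≡.cong F eq)) (sym (fi≈Fιi i′))))

    HasOrder-enumerates : ∀ {g} → (∀ a → N (powℕ g a)) → HasOrder g m →
                          ∀ x → N x → ∃ λ (a : Fin m) → x ≈ powℕ g (toℕ a)
    HasOrder-enumerates g^a∈N ord = HasSize-injective⇒onto (λ a → powℕ _ (toℕ a)) (λ a → g^a∈N (toℕ a))
      (λ a b g^a≈g^b → toℕ-injective (HasOrder-pow-injective ord (toℕ<n a) (toℕ<n b) g^a≈g^b))

    powers-repeat : ∀ {g} → (∀ a → N (powℕ g a)) → ∃ λ e → 0 < e × e ≤ m × powℕ g e ≈ ε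
    powers-repeat {g} g^a∈N =
      let i , j , i<j , same-index = pigeonhole (n<1+n m) index
      in toℕ j ∸ toℕ i , m<n⇒0<n∸m i<j , ≤-trans (m∸n≤m (toℕ j) (toℕ i)) (<⇒≤pred (toℕ<n j)) ,
         pow-≈⇒pow-∸≈ε g (<⇒≤ i<j)
           (trans (g^a≈F i) (trans (reflexive (≡.cong F same-index)) (sym (g^a≈F j))))
      where
      index : Fin (suc m) → Fin m
      index a = proj₁ (F-onto _ (g^a∈N (toℕ a)))
      g^a≈F : ∀ a → powℕ g (toℕ a) ≈ F (index a)
      g^a≈F a = proj₂ (F-onto _ (g^a∈N (toℕ a)))

    size≤period : ∀ {g d} .{{_ : NonZero d}} → (∀ x → N x → ⟨ g ⟩ x) → powℕ g d ≈ ε → m ≤ d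
    size≤period {g} {d} N⊆⟨g⟩ g^d≈ε = injective⇒≤ {f = exponent} λ {i} {j} eq →
      F-injective i j
        (trans (F≈g^exponent i) (trans (reflexive (≡.cong (powℕ g ∘ toℕ) eq)) (sym (F≈g^exponent j))))
      where
      log : ∀ i → ∃ λ k → F i ≈ powℤ g k
      log i = N⊆⟨g⟩ (F i) (F∈N i)
      exponent : Fin m → Fin d
      exponent i = proj₁ (powℤ-reduce g^d≈ε (proj₁ (log i)))
      F≈g^exponent : ∀ i → F i ≈ powℕ g (toℕ (exponent i))
      F≈g^exponent i = trans (proj₂ (log i)) (proj₂ (powℤ-reduce g^d≈ε (proj₁ (log i))))

  generator-order : ∀ {ℓN} {N : Pred Carrier ℓN} {g m} → SameSet ⟨ g ⟩ N → HasSize N m → HasOrder g m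
  generator-order {N = N} {g} {m} (⟨g⟩⊆N , N⊆⟨g⟩) size =
    HasOrder-intro {{m≢0}} g^m≈ε (λ _ → size≤period size N⊆⟨g⟩)
    where
    g^a∈N : ∀ a → N (powℕ g a)
    g^a∈N a = ⟨g⟩⊆N _ (ℤ.+ a , refl)
    m≢0 : NonZero m
    m≢0 = nonZeroIndex (proj₁ (proj₂ (proj₂ (proj₂ size)) ε (g^a∈N 0)))
    g^m≈ε : powℕ g m ≈ ε
    g^m≈ε =
      let e , 0<e , e≤m , g^e≈ε = powers-repeat size g^a∈N
          m≤e = size≤period size {{>-nonZero 0<e}} N⊆⟨g⟩ g^e≈ε
      in trans (reflexive (≡.cong (powℕ g) (≤-antisym m≤e e≤m))) g^e≈ε

  prod-++ : ∀ xs ys → prod (xs ++ ys) ≈ prod xs ∙ prod ys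
  prod-++ []       ys = sym (identityˡ _)
  prod-++ (x ∷ xs) ys = trans (∙-congˡ (prod-++ xs ys)) (sym (assoc _ _ _))

  prod-map-pow : ∀ g es → prod (map (powℕ g) es) ≈ powℕ g (sum es)
  prod-map-pow g []       = refl
  prod-map-pow g (e ∷ es) = trans (∙-congˡ (prod-map-pow g es)) (sym (pow-+ g e (sum es)))

  prod-concat-replicate : ∀ w k → prod (concat (replicate k w)) ≈ powℕ (prod w) k
  prod-concat-replicate w zero    = refl
  prod-concat-replicate w (suc k) = trans (prod-++ w _) (∙-congˡ (prod-concat-replicate w k))

  length-concat-replicate : ∀ (w : List Carrier) k → length (concat (replicate k w)) ≡ k * length w
  length-concat-replicate w zero    = ≡.refl
  length-concat-replicate w (suc k) = ≡.trans (length-++ w) (≡.cong (length w +_) (length-concat-replicate w k))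

  vertex-length : ∀ w → vertex w (length w) ≡ prod w
  vertex-length w = ≡.cong prod (take-all (length w) w ≤-refl)

  vertex-++ˡ : ∀ xs ys {i} → i ≤ length xs → vertex (xs ++ ys) i ≡ vertex xs i
  vertex-++ˡ xs       ys {zero}  _         = ≡.refl
  vertex-++ˡ (x ∷ xs) ys {suc i} (s≤s i≤n) = ≡.cong (x ∙_) (vertex-++ˡ xs ys i≤n)

  vertex-++ʳ : ∀ xs ys r → vertex (xs ++ ys) (length xs + r) ≈ prod xs ∙ vertex ys r
  vertex-++ʳ []       ys r = sym (identityˡ _)
  vertex-++ʳ (x ∷ xs) ys r = trans (∙-congˡ (vertex-++ʳ xs ys r)) (sym (assoc _ _ _))

  vertex-concat-replicate : ∀ w {k a i} → a < k → i ≤ length w →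
                            vertex (concat (replicate k w)) (a * length w + i) ≈ powℕ (prod w) a ∙ vertex w i
  vertex-concat-replicate w {suc k} {zero}  {i} _         i≤n =
    trans (reflexive (vertex-++ˡ w _ i≤n)) (sym (identityˡ _))
  vertex-concat-replicate w {suc k} {suc a} {i} (s<s a<k) i≤n = begin
    vertex (w ++ R) (length w + a * length w + i)    ≡⟨ ≡.cong (vertex (w ++ R)) (+-assoc (length w) _ i) ⟩
    vertex (w ++ R) (length w + (a * length w + i))  ≈⟨ vertex-++ʳ w R _ ⟩
    prod w ∙ vertex R (a * length w + i)             ≈⟨ ∙-congˡ (vertex-concat-replicate w a<k i≤n) ⟩
    prod w ∙ (powℕ (prod w) a ∙ vertex w i)          ≈⟨ assoc _ _ _ ⟨
    powℕ (prod w) (suc a) ∙ vertex w i               ∎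
    where
    R : List Carrier
    R = concat (replicate k w)

  prod-replace : ∀ xs {x y n} ys {ys′ w} → y ≈ x ∙ n → prod ys′ ≈ prod ys ∙ w →
                 prod (xs ++ y ∷ ys′) ≈ prod (xs ++ x ∷ ys) ∙ (conj (prod ys) n ∙ w)
  prod-replace xs {x} {y} {n} ys {ys′} {w} y≈xn ys′≈ysw = begin
    prod (xs ++ y ∷ ys′)                  ≈⟨ prod-++ xs _ ⟩
    prod xs ∙ (y ∙ prod ys′)              ≈⟨ ∙-congˡ (∙-cong y≈xn ys′≈ysw) ⟩
    prod xs ∙ ((x ∙ n) ∙ (Z ∙ w))         ≈⟨ solve monoid ⟩
    prod xs ∙ (x ∙ (n ∙ Z) ∙ w)           ≈⟨ ∙-congˡ (∙-congʳ (∙-congˡ (\\-leftDividesˡ Z (n ∙ Z)))) ⟨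
    prod xs ∙ (x ∙ (Z ∙ conj Z n) ∙ w)    ≈⟨ solve monoid ⟩
    (prod xs ∙ (x ∙ Z)) ∙ (conj Z n ∙ w)  ≈⟨ ∙-congʳ (prod-++ xs _) ⟨
    prod (xs ++ x ∷ ys) ∙ (conj Z n ∙ w)  ∎
    where
    Z : Carrier
    Z = prod ys

  prod-swap₃ : ∀ as {x₁ y₁} bs {x₂ y₂} cs {x₃ y₃} ds {h c₀ c₁ c₂ c₃} →
               prod (as ++ x₁ ∷ bs ++ x₂ ∷ cs ++ x₃ ∷ ds) ≈ powℕ h c₀ →
               conj (prod (bs ++ x₂ ∷ cs ++ x₃ ∷ ds)) (x₁ \\ y₁) ≈ powℕ h c₁ →
               conj (prod (cs ++ x₃ ∷ ds)) (x₂ \\ y₂) ≈ powℕ h c₂ →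
               conj (prod ds) (x₃ \\ y₃) ≈ powℕ h c₃ →
               ∀ b₁ b₂ b₃ → prod (as ++ (if b₁ then y₁ else x₁) ∷ bs ++ (if b₂ then y₂ else x₂) ∷
                                  cs ++ (if b₃ then y₃ else x₃) ∷ ds)
                            ≈ powℕ h (cubeSum c₀ c₁ c₂ c₃ b₁ b₂ b₃)
  prod-swap₃ as {x₁} {y₁} bs {x₂} {y₂} cs {x₃} {y₃} ds {h} {c₀} {c₁} {c₂} {c₃} C≈h^c₀ t₁≈h^c₁ t₂≈h^c₂ t₃≈h^c₃
             b₁ b₂ b₃ = begin
    prod swapped
      ≈⟨ prod-replace as T₁ (if-≈ b₁) (prod-replace bs T₂ (if-≈ b₂)
           (prod-replace cs ds (if-≈ b₃) (sym (identityʳ _)))) ⟩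
    prod (as ++ x₁ ∷ T₁) ∙ prod twists
      ≈⟨ ∙-cong C≈h^c₀ (∙-cong (twist-pow T₁ b₁ t₁≈h^c₁)
                       (∙-cong (twist-pow T₂ b₂ t₂≈h^c₂) (∙-congʳ (twist-pow ds b₃ t₃≈h^c₃)))) ⟩
    powℕ h c₀ ∙ prod (map (powℕ h) bits)   ≈⟨ ∙-congˡ (prod-map-pow h bits) ⟩
    powℕ h c₀ ∙ powℕ h (sum bits)          ≈⟨ pow-+ h c₀ (sum bits) ⟨
    powℕ h (cubeSum c₀ c₁ c₂ c₃ b₁ b₂ b₃)  ∎
    where
    T₂ T₁ swapped : List Carrier
    T₂ = cs ++ x₃ ∷ ds
    T₁ = bs ++ x₂ ∷ T₂
    swapped = as ++ (if b₁ then y₁ else x₁) ∷ bs ++ (if b₂ then y₂ else x₂) ∷ cs ++ (if b₃ then y₃ else x₃) ∷ ds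
    bits : List ℕ
    bits = bit c₁ b₁ ∷ bit c₂ b₂ ∷ bit c₃ b₃ ∷ []
    twist : Bool → List Carrier → Carrier → Carrier
    twist b T n = conj (prod T) (if b then n else ε)
    twists : List Carrier
    twists = twist b₁ T₁ (x₁ \\ y₁) ∷ twist b₂ T₂ (x₂ \\ y₂) ∷ twist b₃ ds (x₃ \\ y₃) ∷ []
    if-≈ : ∀ {x y} b → (if b then y else x) ≈ x ∙ (if b then x \\ y else ε)
    if-≈ {x} {y} true  = sym (\\-leftDividesˡ x y)
    if-≈         false = sym (identityʳ _)
    twist-pow : ∀ T {n c} b → conj (prod T) n ≈ powℕ h c → twist b T n ≈ powℕ h (bit c b)
    twist-pow T true  t≈h^c = t≈h^c
    twist-pow T false _     = conj-ε (prod T)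

  SymClosure-⁻¹ : ∀ {ℓS} {S : Pred Carrier ℓS} {x} → SymClosure S x → SymClosure S (x ⁻¹)
  SymClosure-⁻¹ (u , u∈S , inj₁ x≈u)   = u , u∈S , inj₂ (⁻¹-cong x≈u)
  SymClosure-⁻¹ (u , u∈S , inj₂ x≈u⁻¹) = u , u∈S , inj₁ (trans (⁻¹-cong x≈u⁻¹) (⁻¹-involutive u))

  -- Cosets of a normal subgroup

  module _ {ℓN} {N : Pred Carrier ℓN} (normal : IsNormalSubgroup N) where
    open IsNormalSubgroup normal

    N-conj : ∀ g {x} → N x → N (conj g x)
    N-conj g x∈N = resp (trans (assoc _ _ _) (∙-congˡ (∙-congˡ (⁻¹-involutive g)))) (conj-closed (g ⁻¹) x∈N)

    N-pow : ∀ {x} → N x → ∀ a → N (powℕ x a)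
    N-pow x∈N zero    = ε∈
    N-pow x∈N (suc a) = ∙-closed x∈N (N-pow x∈N a)

    coset-reflexive : ∀ {x y} → x ≈ y → SameCoset N x y
    coset-reflexive {x} x≈y = resp (trans (sym (inverseˡ x)) (∙-congˡ x≈y)) ε∈

    coset-sym : ∀ {x y} → SameCoset N x y → SameCoset N y x
    coset-sym {x} {y} x~y =
      resp (trans (⁻¹-anti-homo-∙ (x ⁻¹) y) (∙-congˡ (⁻¹-involutive x))) (⁻¹-closed x~y)

    coset-trans : ∀ {x y z} → SameCoset N x y → SameCoset N y z → SameCoset N x z
    coset-trans {x} {y} {z} x~y y~z = resp (cancelᶜ (inverseʳ y) (x ⁻¹) z) (∙-closed x~y y~z)

    coset-∙ : ∀ {a a′ x x′} → SameCoset N a a′ → SameCoset N x x′ → SameCoset N (a ∙ x) (a′ ∙ x′)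
    coset-∙ {a} {a′} {x} {x′} a~a′ x~x′ = resp (begin
      conj x (a ⁻¹ ∙ a′) ∙ (x ⁻¹ ∙ x′)        ≈⟨ solve monoid ⟩
      (x ⁻¹ ∙ (a ⁻¹ ∙ a′) ∙ x) ∙ (x ⁻¹ ∙ x′)  ≈⟨ cancelᶜ (inverseʳ x) _ x′ ⟩
      x ⁻¹ ∙ (a ⁻¹ ∙ a′) ∙ x′                 ≈⟨ solve monoid ⟩
      (x ⁻¹ ∙ a ⁻¹) ∙ (a′ ∙ x′)               ≈⟨ ∙-congʳ (⁻¹-anti-homo-∙ a x) ⟨
      (a ∙ x) ⁻¹ ∙ (a′ ∙ x′)                  ∎) (∙-closed (N-conj x a~a′) x~x′)

    coset⇒∙⁻¹∈N : ∀ {x y} → SameCoset N x y → N (y ∙ x ⁻¹)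
    coset⇒∙⁻¹∈N {x} {y} x~y = resp (∙-congʳ (\\-leftDividesˡ x y)) (conj-closed x x~y)

    coset-cancelˡ : ∀ {u v x y} → N u → N v → u ∙ x ≈ v ∙ y → SameCoset N x y
    coset-cancelˡ {u} {v} {x} {y} u∈N v∈N ux≈vy = resp (∙-congˡ (begin
      (v ⁻¹ ∙ u) ∙ x  ≈⟨ assoc _ _ _ ⟩
      v ⁻¹ ∙ (u ∙ x)  ≈⟨ ∙-congˡ ux≈vy ⟩
      v ⁻¹ ∙ (v ∙ y)  ≈⟨ \\-leftDividesʳ v y ⟩
      y               ∎)) (N-conj x (∙-closed (⁻¹-closed v∈N) u∈N))

    vertex-coset : ∀ {w w′} → Pointwise (SameCoset N) w w′ → ∀ k → SameCoset N (vertex w k) (vertex w′ k)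
    vertex-coset _          zero    = coset-reflexive refl
    vertex-coset []         (suc k) = coset-reflexive refl
    vertex-coset (x~y ∷ w~) (suc k) = coset-∙ x~y (vertex-coset w~ k)

    IsHamCycleQuot-resp : ∀ {ℓS} {S : Pred Carrier ℓS} {w w′} → Pointwise (SameCoset N) w w′ →
                          All (SymClosure S) w′ → IsHamCycleQuot S N w → IsHamCycleQuot S N w′
    IsHamCycleQuot-resp {w = w} {w′} w~w′ S-letters (_ , closed , distinct , cover) =
      S-letters , closed′ , distinct′ , cover′
      where
      |w|≡|w′| : length w ≡ length w′
      |w|≡|w′| = Pointwise-length w~w′
      v~v′ : ∀ k → SameCoset N (vertex w k) (vertex w′ k)
      v~v′ = vertex-coset w~w′
      closed′ : SameCoset N (vertex w′ (length w′)) ε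
      closed′ = ≡.subst (λ n → SameCoset N (vertex w′ n) ε) |w|≡|w′|
                        (coset-trans (coset-sym (v~v′ (length w))) closed)
      distinct′ : ∀ i j → SameCoset N (vertex w′ (toℕ i)) (vertex w′ (toℕ j)) → i ≡ j
      distinct′ i j vᵢ~vⱼ =
        toℕ-injective (≡.trans (≡.sym (toℕ-cast _ i)) (≡.trans (≡.cong toℕ i≡j) (toℕ-cast _ j)))
        where
        i≡j : cast (≡.sym |w|≡|w′|) i ≡ cast (≡.sym |w|≡|w′|) j
        i≡j = distinct _ _ (≡.subst₂ (λ a b → SameCoset N (vertex w a) (vertex w b))
          (≡.sym (toℕ-cast _ i)) (≡.sym (toℕ-cast _ j))
          (coset-trans (v~v′ (toℕ i)) (coset-trans vᵢ~vⱼ (coset-sym (v~v′ (toℕ j))))))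
      cover′ : ∀ x → ∃ λ i → SameCoset N x (vertex w′ (toℕ i))
      cover′ x = let i , x~vᵢ = cover x in
        cast |w|≡|w′| i ,
        ≡.subst (λ n → SameCoset N x (vertex w′ n)) (≡.sym (toℕ-cast |w|≡|w′| i))
                (coset-trans x~vᵢ (v~v′ (toℕ i)))

    IsHamCycleQuot⇒prod∈N : ∀ {ℓS} {S : Pred Carrier ℓS} {w} → IsHamCycleQuot S N w → N (prod w)
    IsHamCycleQuot⇒prod∈N {w = w} (_ , closed , _) =
      resp (trans (∙-congʳ ε⁻¹≈ε) (trans (identityˡ _) (reflexive (vertex-length w)))) (coset-sym closed)

    -- The factor group lemma

    module _ {ℓS} {S : Pred Carrier ℓS} {m} {w : List Carrier}
             (size : HasSize N m) (ham : IsHamCycleQuot S N w) (ord : HasOrder (prod w) m) where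
      private
        V : Carrier
        V = prod w
        L : ℕ
        L = length w
        W : List Carrier
        W = concat (replicate m w)

        V^a∈N : ∀ a → N (powℕ V a)
        V^a∈N = N-pow (IsHamCycleQuot⇒prod∈N ham)

        |W|≡m*L : length W ≡ m * L
        |W|≡m*L = length-concat-replicate w m

        vertex-W : ∀ {k : Fin (length W)} (a : Fin m) (i : Fin L) → toℕ k ≡ toℕ a * L + toℕ i →
                   vertex W (toℕ k) ≈ powℕ V (toℕ a) ∙ vertex w (toℕ i)
        vertex-W a i k≡aL+i =
          trans (reflexive (≡.cong (vertex W) k≡aL+i)) (vertex-concat-replicate w (toℕ<n a) (<⇒≤ (toℕ<n i)))

        index : (k : Fin (length W)) → ∃ λ (a : Fin m) → ∃ λ (i : Fin L) → toℕ k ≡ toℕ a * L + toℕ i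
        index k = let a , i , k≡aL+i = Fin-decompose (cast |W|≡m*L k)
                  in a , i , ≡.trans (≡.sym (toℕ-cast _ k)) k≡aL+i

        closed : vertex W (length W) ≈ ε
        closed = begin
          vertex W (length W)  ≡⟨ vertex-length W ⟩
          prod W               ≈⟨ prod-concat-replicate w m ⟩
          powℕ V m             ≈⟨ from (ord m) ∣-refl ⟩
          ε                    ∎

        distinct : ∀ k₁ k₂ → vertex W (toℕ k₁) ≈ vertex W (toℕ k₂) → k₁ ≡ k₂
        distinct k₁ k₂ v₁≈v₂ with index k₁ | index k₂
        ... | a₁ , i₁ , k₁≡ | a₂ , i₂ , k₂≡ =
          toℕ-injective
            (≡.trans k₁≡ (≡.trans (≡.cong₂ (λ a i → toℕ a * L + toℕ i) a₁≡a₂ i₁≡i₂) (≡.sym k₂≡)))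
          where
          split≈ : powℕ V (toℕ a₁) ∙ vertex w (toℕ i₁) ≈ powℕ V (toℕ a₂) ∙ vertex w (toℕ i₂)
          split≈ = trans (sym (vertex-W a₁ i₁ k₁≡)) (trans v₁≈v₂ (vertex-W a₂ i₂ k₂≡))
          i₁≡i₂ : i₁ ≡ i₂
          i₁≡i₂ = proj₁ (proj₂ (proj₂ ham)) i₁ i₂
                    (coset-cancelˡ (V^a∈N (toℕ a₁)) (V^a∈N (toℕ a₂)) split≈)
          a₁≡a₂ : a₁ ≡ a₂
          a₁≡a₂ = toℕ-injective (HasOrder-pow-injective ord (toℕ<n a₁) (toℕ<n a₂) (∙-cancelʳ _ _ _
            (≡.subst (λ i → _ ≈ powℕ V (toℕ a₂) ∙ vertex w (toℕ i)) (≡.sym i₁≡i₂) split≈)))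

        cover : ∀ x → ∃ λ k → x ≈ vertex W (toℕ k)
        cover x =
          let i , x~vᵢ = proj₂ (proj₂ (proj₂ ham)) x
              vᵢ = vertex w (toℕ i)
              a , xvᵢ⁻¹≈V^a =
                HasOrder-enumerates size V^a∈N ord (x ∙ vᵢ ⁻¹) (coset⇒∙⁻¹∈N (coset-sym x~vᵢ))
              k = cast (≡.sym |W|≡m*L) (combine a i)
          in k , (begin
            x                    ≈⟨ insertʳ (inverseˡ vᵢ) x ⟩
            x ∙ vᵢ ⁻¹ ∙ vᵢ       ≈⟨ ∙-congʳ xvᵢ⁻¹≈V^a ⟩
            powℕ V (toℕ a) ∙ vᵢ  ≈⟨ vertex-W a i (≡.trans (toℕ-cast _ (combine a i)) (toℕ-combine′ a i)) ⟨
            vertex W (toℕ k)     ∎)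

      factor-group-lemma : HasHamCycle S
      factor-group-lemma = W , concat⁺ (replicate⁺ m (proj₁ ham)) , closed , distinct , cover

    -- Swapping letters

    Swappable : ∀ {ℓS} → Pred Carrier ℓS → ℕ → Carrier → Carrier → Set _
    Swappable S m x y = SymClosure S y × SameCoset N x y × HasOrder (x \\ y) m

    swap-letter : ∀ {ℓS} {S : Pred Carrier ℓS} {m s t} → N (s \\ t) → HasOrder (s \\ t) m → SymClosure S t →
                  ∀ {x} → x ≈ s ⊎ x ≈ s ⁻¹ → ∃ λ y → Swappable S m x y
    swap-letter {s = s} {t} h∈N h-order t∈S± {x} (inj₁ x≈s) =
      _ , t∈S± , resp h≈x\\t h∈N , HasOrder-cong h≈x\\t h-order
      where
      h≈x\\t : s \\ t ≈ x \\ t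
      h≈x\\t = ∙-congʳ (⁻¹-cong (sym x≈s))
    swap-letter {s = s} {t} h∈N h-order t∈S± {x} (inj₂ x≈s⁻¹) =
      _ , SymClosure-⁻¹ t∈S± , resp twist≈x\\t⁻¹ (N-conj (s ⁻¹) (⁻¹-closed h∈N)) ,
      HasOrder-cong twist≈x\\t⁻¹ (HasOrder-conj (s ⁻¹) (HasOrder-⁻¹ h-order))
      where
      twist≈x\\t⁻¹ : conj (s ⁻¹) ((s \\ t) ⁻¹) ≈ x \\ t ⁻¹
      twist≈x\\t⁻¹ = begin
        s ⁻¹ ⁻¹ ∙ ((s ⁻¹ ∙ t) ⁻¹ ∙ s ⁻¹)  ≈⟨ ∙-congˡ (∙-congʳ (⁻¹-anti-homo-∙ (s ⁻¹) t)) ⟩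
        s ⁻¹ ⁻¹ ∙ (t ⁻¹ ∙ s ⁻¹ ⁻¹ ∙ s ⁻¹)  ≈⟨ ∙-congˡ (cancelʳ (inverseˡ (s ⁻¹)) (t ⁻¹)) ⟩
        s ⁻¹ ⁻¹ ∙ t ⁻¹                    ≈⟨ ∙-congʳ (⁻¹-cong x≈s⁻¹) ⟨
        x ⁻¹ ∙ t ⁻¹                       ∎

    swappable-swap₃ : ∀ {ℓS} {S : Pred Carrier ℓS} {m} as {x₁ y₁} bs {x₂ y₂} cs {x₃ y₃} ds →
                      IsHamCycleQuot S N (as ++ x₁ ∷ bs ++ x₂ ∷ cs ++ x₃ ∷ ds) →
                      Swappable S m x₁ y₁ → Swappable S m x₂ y₂ → Swappable S m x₃ y₃ → ∀ b₁ b₂ b₃ →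
                      IsHamCycleQuot S N (as ++ (if b₁ then y₁ else x₁) ∷ bs ++ (if b₂ then y₂ else x₂) ∷
                                          cs ++ (if b₃ then y₃ else x₃) ∷ ds)
    swappable-swap₃ {S = S} as bs cs ds ham (y₁∈S± , x₁~y₁ , _) (y₂∈S± , x₂~y₂ , _) (y₃∈S± , x₃~y₃ , _)
                    b₁ b₂ b₃ =
      IsHamCycleQuot-resp
        (Pointwise-swap₃ (coset-reflexive refl) as bs cs ds x₁~y₁ x₂~y₂ x₃~y₃ b₁ b₂ b₃)
        (All-resp-Pointwise (λ r → r) (Pointwise-swap₃ {R = λ x y → SymClosure S x → SymClosure S y} (λ s → s)
          as bs cs ds (λ _ → y₁∈S±) (λ _ → y₂∈S±) (λ _ → y₃∈S±) b₁ b₂ b₃) (proj₁ ham))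
        ham

    module _ {ℓS} {S : Pred Carrier ℓS} {p q : ℕ} (p-prime : Prime p) (q-prime : Prime q) (2<p : 2 < p) (2<q : 2 < q)
             (size : HasSize N (p * q)) {h : Carrier} (gen : SameSet ⟨ h ⟩ N) where
      private
        instance
          pq≢0 : NonZero (p * q)
          pq≢0 = m*n≢0 p q {{prime⇒nonZero p-prime}} {{prime⇒nonZero q-prime}}

        h-order : HasOrder h (p * q)
        h-order = generator-order gen size

        log : ∀ {x} → N x → ∃ λ c → x ≈ powℕ h c
        log x∈N = let a , x≈h^a = HasOrder-enumerates size (λ a → proj₁ gen _ (ℤ.+ a , refl)) h-order _ x∈N
                  in toℕ a , x≈h^a

        twist-log : ∀ {x y} T → Swappable S (p * q) x y →
                    ∃ λ c → Coprime (p * q) c × conj (prod T) (x \\ y) ≈ powℕ h c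
        twist-log T (_ , x~y , ord) =
          let c , twist≈h^c = log (N-conj (prod T) x~y)
          in c , HasOrder-pow⇒coprime h-order (HasOrder-cong twist≈h^c (HasOrder-conj (prod T) ord)) , twist≈h^c

      generating-swap₃ : ∀ as {x₁ y₁} bs {x₂ y₂} cs {x₃ y₃} ds →
                         IsHamCycleQuot S N (as ++ x₁ ∷ bs ++ x₂ ∷ cs ++ x₃ ∷ ds) →
                         Swappable S (p * q) x₁ y₁ → Swappable S (p * q) x₂ y₂ → Swappable S (p * q) x₃ y₃ →
                         ∃ λ w → IsHamCycleQuot S N w × HasOrder (prod w) (p * q)
      generating-swap₃ as bs cs ds ham sw₁ sw₂ sw₃ =
        let c₀ , C≈h^c₀ = log (IsHamCycleQuot⇒prod∈N ham)
            c₁ , pq⊥c₁ , t₁≈h^c₁ = twist-log (bs ++ _ ∷ cs ++ _ ∷ ds) sw₁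
            c₂ , pq⊥c₂ , t₂≈h^c₂ = twist-log (cs ++ _ ∷ ds) sw₂
            c₃ , pq⊥c₃ , t₃≈h^c₃ = twist-log ds sw₃
            b₁ , b₂ , b₃ , pq⊥e = coprime-cubeSum p-prime q-prime 2<p 2<q c₀ pq⊥c₁ pq⊥c₂ pq⊥c₃
        in _ , swappable-swap₃ as bs cs ds ham sw₁ sw₂ sw₃ b₁ b₂ b₃ ,
           HasOrder-cong
             (sym (prod-swap₃ as bs cs ds {h} {c₀} {c₁} {c₂} {c₃} C≈h^c₀ t₁≈h^c₁ t₂≈h^c₂ t₃≈h^c₃ b₁ b₂ b₃))
             (HasOrder-pow h-order pq⊥e)

corollary2p21 : ∀ {c ℓ p₁ p₂ : Level} (G : Group c ℓ) → let open GroupDefs G in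
  Finite →
  (p q : ℕ) → Prime p → Prime q → 3 < p → 3 < q → p ≢ q →
  (N : Pred Carrier p₁) → IsNormalSubgroup N → IsCyclic N → HasSize N (p * q) →
  (S : Pred Carrier p₂) → Generates S →
  (C : List Carrier) → IsHamCycleQuot S N C →
  (s t : Carrier) → SymClosure S s → SymClosure S t → SameSet ⟨ s ⁻¹ ∙ t ⟩ N →
  AtLeast3Occ C s →
  HasHamCycle S
corollary2p21 G _ p q p-prime q-prime 3<p 3<q _ N normal _ size S _ C ham s t _ t∈S± gen
              (i , j , k , i<j , j<k , xᵢ≈s± , xⱼ≈s± , xₖ≈s±) =
  let as , bs , cs , ds , C≡ = split-at₃ C i<j j<k
      swap = swap-letter G normal (proj₁ gen _ (ℤ.+ 1 , sym (identityʳ _))) (generator-order G gen size) t∈S±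
      w , w-ham , w-order = generating-swap₃ G normal p-prime q-prime (<-trans (n<1+n 2) 3<p) (<-trans (n<1+n 2) 3<q)
        size gen as bs cs ds (≡.subst (IsHamCycleQuot S N) C≡ ham)
        (proj₂ (swap xᵢ≈s±)) (proj₂ (swap xⱼ≈s±)) (proj₂ (swap xₖ≈s±))
  in factor-group-lemma G normal size w-ham w-order
  where open GroupDefs G
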